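{- Let $G$ be a finite, simple, undirected, connected graph on $n\geq 3$ vertices which has no induced $C_4$ and has no pair of false-twin vertices, and such that the set $\mathcal{A}$ of alone vertices of $G$ has a good assignment. Then $G$ has at least $\lceil \frac{n}{2} \rceil$ bicliques.
   Context: All graphs are finite, simple, undirected and connected (standing assumption of the paper). A biclique of $G$ is a maximal (with respect to vertex-set inclusion) induced subgraph of $G$ that is a complete bipartite graph $K_{p,q}$ with $p,q\geq 1$; bicliques are counted as distinct vertex sets. $N(v)$ is the open neighborhood and $N[v]=N(v)\cup\{v\}$ the closed neighborhood. Two distinct vertices $u,v$ are false-twins if $N(u)=N(v)$ and true-twins if $N[u]=N[v]$. A vertex $v$ is dominated by a vertex $v'$ if $N[v]\subseteq N[v']$. A vertex $v$ is simplicial if $\{v\}\cup N(v)$ is a clique. A vertex $x$ is alone if $x$ is simplicial and no vertex of $N(x)$ is simplicial; $\mathcal{A}$ denotes the set of alone vertices. An assignment for $\mathcal{A}$ associates to each alone vertex $x$ a vertex $v$ and an edge $vv'$ with $v,v'\in N(x)$, such that either $v$ is not dominated by $v'$ or $v$ and $v'$ are true-twins. The assignment is good if whenever two different alone vertices have the same associated edge, the endpoints of that edge are not true-twins and the vertices associated to the two alone vertices are different. $\mathcal{A}$ has a good assignment if some good assignment for $\mathcal{A}$ exists. -}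

module Defs where

open import Data.Nat using (ℕ; _≤_; ⌈_/2⌉)
open import Data.Fin using (Fin)
open import Data.Fin.Subset using (Subset; _∈_; _∉_; _⊆_; Nonempty)
open import Data.Product using (Σ; _×_; _,_; ∃)
open import Data.Sum using (_⊎_)
open import Data.List using (List; length)
open import Data.List.Relation.Unary.All using (All)
open import Data.List.Relation.Unary.Unique.Propositional using (Unique)
open import Relation.Nullary using (¬_; Dec)
open import Relation.Binary.PropositionalEquality using (_≡_; _≢_)
open import Relation.Binary.Construct.Closure.ReflexiveTransitive using (Star)
open import Function.Bundles using (_⇔_)

record Graph (n : ℕ) : Set₁ where
  field
    Adj     : Fin n → Fin n → Set
    adj?    : ∀ u v → Dec (Adj u v)
    sym     : ∀ {u v} → Adj u v → Adj v u
    irrefl  : ∀ u → ¬ Adj u u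

module _ {n : ℕ} (G : Graph n) where
  open Graph G

  Connected : Set
  Connected = ∀ u v → Star Adj u v

  InN[_] : Fin n → Fin n → Set
  InN[ v ] w = w ≡ v ⊎ Adj v w

  HasInducedC4 : Set
  HasInducedC4 = Σ (Fin n) λ a → Σ (Fin n) λ b → Σ (Fin n) λ c → Σ (Fin n) λ d →
    a ≢ c × b ≢ d × Adj a b × Adj b c × Adj c d × Adj d a × ¬ Adj a c × ¬ Adj b d

  FalseTwins : Fin n → Fin n → Set
  FalseTwins u v = u ≢ v × (∀ w → Adj u w ⇔ Adj v w)

  TrueTwins : Fin n → Fin n → Set
  TrueTwins u v = u ≢ v × (∀ w → InN[ u ] w ⇔ InN[ v ] w)

  DominatedBy : Fin n → Fin n → Set
  DominatedBy v v' = ∀ w → InN[ v ] w → InN[ v' ] w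

  Simplicial : Fin n → Set
  Simplicial v = ∀ a b → InN[ v ] a → InN[ v ] b → a ≢ b → Adj a b

  Alone : Fin n → Set
  Alone x = Simplicial x × (∀ y → Adj x y → ¬ Simplicial y)

  -- An assignment associates to each vertex x a pair (v , v'): the vertex v and the edge vv'.
  -- Only its values on alone vertices matter.
  IsAssignment : (Fin n → Fin n × Fin n) → Set
  IsAssignment f = ∀ x → Alone x → let (v , v') = f x in
    Adj x v × Adj x v' × Adj v v' × (¬ DominatedBy v v' ⊎ TrueTwins v v')

  SameEdge : Fin n × Fin n → Fin n × Fin n → Set
  SameEdge (v , v') (w , w') = (v ≡ w × v' ≡ w') ⊎ (v ≡ w' × v' ≡ w)

  IsGoodAssignment : (Fin n → Fin n × Fin n) → Set
  IsGoodAssignment f = IsAssignment f ×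
    (∀ x y → Alone x → Alone y → x ≢ y → SameEdge (f x) (f y) →
       let (v , v') = f x ; (w , w') = f y in ¬ TrueTwins v v' × v ≢ w)

  HasGoodAssignment : Set
  HasGoodAssignment = Σ (Fin n → Fin n × Fin n) IsGoodAssignment

  IsInducedCompleteBipartite : Subset n → Set
  IsInducedCompleteBipartite S = Σ (Subset n) λ X → Σ (Subset n) λ Y →
    Nonempty X × Nonempty Y ×
    (∀ u → u ∈ S ⇔ (u ∈ X ⊎ u ∈ Y)) ×
    (∀ u → u ∈ X → u ∉ Y) ×
    (∀ u v → u ∈ X → v ∈ Y → Adj u v) ×
    (∀ u v → u ∈ X → v ∈ X → ¬ Adj u v) ×
    (∀ u v → u ∈ Y → v ∈ Y → ¬ Adj u v)

  IsBiclique : Subset n → Set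
  IsBiclique S = IsInducedCompleteBipartite S ×
    (∀ T → S ⊆ T → IsInducedCompleteBipartite T → T ≡ S)

  AtLeastBicliques : ℕ → Set
  AtLeastBicliques k = Σ (List (Subset n)) λ L →
    Unique L × All IsBiclique L × k ≤ length L

-- Every vertex x is charged to a biclique: a star centred at x if x is not
-- simplicial; the edge {x, s} for a simplicial neighbour s if x is simplicial
-- but not alone; and, for an alone x with assigned edge vv', either the star
-- centred at v through v' that contains every alone neighbour of v outside
-- N(v'), or the edge {v, v'} when v and v' are true twins.  Stars are maximal
-- because G has no induced C4, edges because their ends are true twins.
-- Two distinct vertices charged to the same biclique are separated by a
-- two-valued label (a star is charged by its centre and by at most one alone
-- vertex, an edge only by its two simplicial ends), so the charging map is at
-- most two-to-one and its image has at least ⌈n/2⌉ elements.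
module Submission where

open import Defs
open import Data.Nat using (ℕ; _≤_; _+_; _*_; ⌈_/2⌉)
open import Data.Nat.Properties using (⌈n/2⌉-mono; n≡⌈n+n/2⌉; *-comm; +-identityʳ; module ≤-Reasoning)
open import Data.Fin using (Fin; zero; suc; combine; _<?_; _≟_)
open import Data.Fin.Properties using (any?; injective⇒≤; combine-injective; <-asym; <-cmp)
open import Data.Fin.Subset using (Subset; _∈_; _⊆_)
open import Data.Fin.Subset.Properties using (⊆-antisym)
open import Data.Vec using (tabulate)
open import Data.Vec.Properties using (lookup∘tabulate; lookup⇒[]=; []=⇒lookup; ≡-dec)
open import Data.Bool.Properties using () renaming (_≟_ to _≟ᵇ_)
open import Data.List using (List; []; _∷_; [_]; length; lookup; map; filter; allFin; deduplicate)
open import Data.List.Membership.Propositional using (find) renaming (_∈_ to _∈ₗ_)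
open import Data.List.Membership.Propositional.Properties
  using (∈-allFin; ∈-map⁺; ∈-map⁻; ∈-filter⁺; ∈-filter⁻; ∈-deduplicate⁺; ∈-deduplicate⁻)
import Data.List.Membership.DecPropositional as DecMembership
open import Data.List.Relation.Binary.Subset.Propositional using () renaming (_⊆_ to _⊆ₗ_)
open import Data.List.Relation.Binary.Subset.Propositional.Properties using (Any-resp-⊆)
open import Data.List.Relation.Unary.Any as Any using (Any; here; there)
open import Data.List.Relation.Unary.Any.Properties using (lookup-index)
open import Data.List.Relation.Unary.All as All using (All; []; _∷_)
open import Data.List.Relation.Unary.Unique.Propositional using (Unique)
open import Data.List.Relation.Unary.Unique.DecPropositional.Properties using (deduplicate-!)
open import Data.Product using (Σ; _×_; _,_; proj₁; proj₂; ∃; ∃₂)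
open import Data.Sum as Sum using (_⊎_; inj₁; inj₂)
open import Data.Empty using (⊥; ⊥-elim)
open import Function using (_∘_; id)
open import Function.Bundles using (_⇔_; mk⇔; Equivalence)
open import Function.Definitions using (Injective)
open import Level using (0ℓ)
open import Relation.Binary using (DecidableEquality; tri<; tri≈; tri>)
open import Relation.Binary.PropositionalEquality using (_≡_; _≢_; refl; sym; trans; cong; subst; module ≡-Reasoning)
open import Relation.Nullary using (¬_; Dec; yes; no; does)
open import Relation.Nullary.Decidable using (dec-true; decidable-stable; _⊎-dec_; _×-dec_; ¬?)
open import Relation.Unary using (Pred; Decidable)
open import Relation.Unary.Properties using (_∪?_)

open Equivalence using (to; from)

module _ {A : Set} (_≟ᴬ_ : DecidableEquality A) where

  image : ∀ {n} → (Fin n → A) → List A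
  image {n} φ = deduplicate _≟ᴬ_ (map φ (allFin n))

  image-unique : ∀ {n} (φ : Fin n → A) → Unique (image φ)
  image-unique φ = deduplicate-! _≟ᴬ_ _

  ∈-image⁺ : ∀ {n} (φ : Fin n → A) i → φ i ∈ₗ image φ
  ∈-image⁺ φ i = ∈-deduplicate⁺ _≟ᴬ_ (∈-map⁺ φ (∈-allFin i))

  ∈-image⁻ : ∀ {n} (φ : Fin n → A) {y} → y ∈ₗ image φ → ∃ λ i → y ≡ φ i
  ∈-image⁻ φ y∈ with ∈-map⁻ φ (∈-deduplicate⁻ _≟ᴬ_ _ y∈)
  ... | i , _ , y≡φi = i , y≡φi

  ≤-length-image : ∀ {n k} (φ : Fin n → A) (κ : Fin n → Fin k) →
    (∀ i j → φ i ≡ φ j → κ i ≡ κ j → i ≡ j) → n ≤ length (image φ) * k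
  ≤-length-image φ κ separates = injective⇒≤ injective
    where
    position : ∀ i → Fin (length (image φ))
    position i = Any.index (∈-image⁺ φ i)

    injective : Injective _≡_ _≡_ (λ i → combine (position i) (κ i))
    injective {i} {j} eq with combine-injective (position i) (κ i) (position j) (κ j) eq
    ... | same-position , same-label = separates i j same-image same-label
      where
      open ≡-Reasoning
      same-image : φ i ≡ φ j
      same-image = begin
        φ i                           ≡⟨ lookup-index (∈-image⁺ φ i) ⟩
        lookup (image φ) (position i) ≡⟨ cong (lookup (image φ)) same-position ⟩
        lookup (image φ) (position j) ≡⟨ sym (lookup-index (∈-image⁺ φ j)) ⟩
        φ j                           ∎

⌈/2⌉-≤ : ∀ {n m} → n ≤ m * 2 → ⌈ n /2⌉ ≤ m
⌈/2⌉-≤ {n} {m} n≤2m = begin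
  ⌈ n /2⌉     ≤⟨ ⌈n/2⌉-mono n≤2m ⟩
  ⌈ m * 2 /2⌉ ≡⟨ cong ⌈_/2⌉ (trans (*-comm m 2) (cong (m +_) (+-identityʳ m))) ⟩
  ⌈ m + m /2⌉ ≡⟨ sym (n≡⌈n+n/2⌉ m) ⟩
  m           ∎
  where open ≤-Reasoning

orientation : ∀ {n} → Fin n → Fin n → Fin 2
orientation i j with i <? j
... | yes _ = zero
... | no _  = suc zero

orientation-flip : ∀ {n} {i j : Fin n} → i ≢ j → orientation i j ≢ orientation j i
orientation-flip {i = i} {j} i≢j with i <? j | j <? i
... | yes i<j | yes j<i = λ _ → <-asym i<j j<i
... | yes _   | no _    = λ ()
... | no _    | yes _   = λ ()
... | no i≮j  | no j≮i  with <-cmp i j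
...   | tri< i<j _ _ = λ _ → i≮j i<j
...   | tri≈ _ i≡j _ = λ _ → i≢j i≡j
...   | tri> _ _ j<i = λ _ → j≮i j<i

no-three-in-pair : ∀ {B : Set} {x y p q r : B} → p ≢ q → q ≢ r → p ≢ r →
  p ≡ x ⊎ p ≡ y → q ≡ x ⊎ q ≡ y → r ≡ x ⊎ r ≡ y → ⊥
no-three-in-pair p≢q _ _ (inj₁ refl) (inj₁ refl) _ = p≢q refl
no-three-in-pair p≢q _ _ (inj₂ refl) (inj₂ refl) _ = p≢q refl
no-three-in-pair _ _ p≢r (inj₁ refl) _ (inj₁ refl) = p≢r refl
no-three-in-pair _ _ p≢r (inj₂ refl) _ (inj₂ refl) = p≢r refl
no-three-in-pair _ q≢r _ _ (inj₁ refl) (inj₁ refl) = q≢r refl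
no-three-in-pair _ q≢r _ _ (inj₂ refl) (inj₂ refl) = q≢r refl

module _ {n : ℕ} where

  subset : {P : Pred (Fin n) 0ℓ} → Decidable P → Subset n
  subset P? = tabulate (does ∘ P?)

  ∈-subset⁺ : {P : Pred (Fin n) 0ℓ} (P? : Decidable P) {u : Fin n} → P u → u ∈ subset P?
  ∈-subset⁺ P? {u} pu = lookup⇒[]= u _ (trans (lookup∘tabulate _ u) (dec-true (P? u) pu))

  ∈-subset⁻ : {P : Pred (Fin n) 0ℓ} (P? : Decidable P) {u : Fin n} → u ∈ subset P? → P u
  ∈-subset⁻ P? {u} u∈ with P? u | trans (sym (lookup∘tabulate (does ∘ P?) u)) ([]=⇒lookup u∈)
  ... | yes pu | _ = pu
  ... | no _   | ()

module _ {n : ℕ} (G : Graph n) where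
  open Graph G renaming (sym to Adj-sym)
  open DecMembership {A = Fin n} _≟_ using (_∈?_)

  record Bipartition (T : Subset n) : Set₁ where
    field
      Side₁ Side₂  : Pred (Fin n) 0ℓ
      cover        : ∀ {u} → u ∈ T → Side₁ u ⊎ Side₂ u
      across       : ∀ {u v} → Side₁ u → Side₂ v → Adj u v
      independent₁ : ∀ {u v} → Side₁ u → Side₁ v → ¬ Adj u v
      independent₂ : ∀ {u v} → Side₂ u → Side₂ v → ¬ Adj u v

  bipartition-through : ∀ {T c} → IsInducedCompleteBipartite G T → c ∈ T →
    Σ (Bipartition T) λ B → Bipartition.Side₁ B c
  bipartition-through (X , Y , _ , _ , ∈⇔ , _ , across , indX , indY) c∈T with to (∈⇔ _) c∈T
  ... | inj₁ c∈X = record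
    { Side₁ = _∈ X ; Side₂ = _∈ Y ; cover = to (∈⇔ _)
    ; across = across _ _ ; independent₁ = indX _ _ ; independent₂ = indY _ _
    } , c∈X
  ... | inj₂ c∈Y = record
    { Side₁ = _∈ Y ; Side₂ = _∈ X ; cover = Sum.swap ∘ to (∈⇔ _)
    ; across = λ u∈Y v∈X → Adj-sym (across _ _ v∈X u∈Y)
    ; independent₁ = indY _ _ ; independent₂ = indX _ _
    } , c∈Y

  complete-bipartite : {P Q : Pred (Fin n) 0ℓ} (P? : Decidable P) (Q? : Decidable Q) →
    ∃ P → ∃ Q → (∀ {u v} → P u → Q v → Adj u v) →
    (∀ {u v} → P u → P v → ¬ Adj u v) → (∀ {u v} → Q u → Q v → ¬ Adj u v) →
    IsInducedCompleteBipartite G (subset (P? ∪? Q?))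
  complete-bipartite P? Q? (x , px) (y , qy) across indP indQ =
    subset P? , subset Q? , (x , ∈-subset⁺ P? px) , (y , ∈-subset⁺ Q? qy) ,
    (λ _ → mk⇔ (Sum.map (∈-subset⁺ P?) (∈-subset⁺ Q?) ∘ ∈-subset⁻ (P? ∪? Q?))
               (∈-subset⁺ (P? ∪? Q?) ∘ Sum.map (∈-subset⁻ P?) (∈-subset⁻ Q?))) ,
    (λ u u∈X u∈Y → irrefl u (across (∈-subset⁻ P? u∈X) (∈-subset⁻ Q? u∈Y))) ,
    (λ _ _ u∈X v∈Y → across (∈-subset⁻ P? u∈X) (∈-subset⁻ Q? v∈Y)) ,
    (λ _ _ u∈X v∈X → indP (∈-subset⁻ P? u∈X) (∈-subset⁻ P? v∈X)) ,
    (λ _ _ u∈Y v∈Y → indQ (∈-subset⁻ Q? u∈Y) (∈-subset⁻ Q? v∈Y))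

  isBiclique⁺ : ∀ {S c} → IsInducedCompleteBipartite G S → c ∈ S →
    (∀ {T} → S ⊆ T → (B : Bipartition T) → Bipartition.Side₁ B c → T ⊆ S) →
    IsBiclique G S
  isBiclique⁺ S-cb c∈S absorbed = S-cb , λ T S⊆T T-cb →
    let B , c∈₁ = bipartition-through T-cb (S⊆T c∈S) in ⊆-antisym (absorbed S⊆T B c∈₁) S⊆T

  IsEdge : Subset n → Fin n → Fin n → Set
  IsEdge M a b = ∀ {u} → u ∈ M ⇔ (u ≡ a ⊎ u ≡ b)

  other-end : ∀ {M a b u} → IsEdge M a b → u ∈ M → u ≢ a → u ≡ b
  other-end E u∈ u≢a with to E u∈
  ... | inj₁ u≡a = ⊥-elim (u≢a u≡a)
  ... | inj₂ u≡b = u≡b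

  same-edge : ∀ {M a b a′ b′} → IsEdge M a b → IsEdge M a′ b′ → a ≢ b → SameEdge G (a , b) (a′ , b′)
  same-edge E F a≢b with to F (from E (inj₁ refl)) | to F (from E (inj₂ refl))
  ... | inj₁ refl | inj₁ refl = ⊥-elim (a≢b refl)
  ... | inj₁ a≡a′ | inj₂ b≡b′ = inj₁ (a≡a′ , b≡b′)
  ... | inj₂ a≡b′ | inj₁ b≡a′ = inj₂ (a≡b′ , b≡a′)
  ... | inj₂ refl | inj₂ refl = ⊥-elim (a≢b refl)

  orientations-of-edge-differ : ∀ {M i j s s′} → i ≢ j → IsEdge M i s → IsEdge M j s′ →
    orientation i s ≢ orientation j s′
  orientations-of-edge-differ i≢j E F
    with other-end E (from F (inj₁ refl)) (i≢j ∘ sym) | other-end F (from E (inj₁ refl)) i≢j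
  ... | refl | refl = orientation-flip i≢j

  twins-isBiclique : ∀ {a b} → Adj a b → TrueTwins G a b →
    Σ (Subset n) λ M → IsBiclique G M × IsEdge M a b
  twins-isBiclique {a} {b} ab (_ , twins) = M , isBiclique⁺ M-cb (∈-subset⁺ ends? (inj₁ refl)) absorbed ,
    mk⇔ (∈-subset⁻ ends?) (∈-subset⁺ ends?)
    where
    ends? : Decidable (λ u → u ≡ a ⊎ u ≡ b)
    ends? = (_≟ a) ∪? (_≟ b)
    M : Subset n
    M = subset ends?
    M-cb : IsInducedCompleteBipartite G M
    M-cb = complete-bipartite (_≟ a) (_≟ b) (a , refl) (b , refl)
      (λ { refl refl → ab }) (λ { refl refl → irrefl a }) (λ { refl refl → irrefl b })
    absorbed : ∀ {T} → M ⊆ T → (B : Bipartition T) → Bipartition.Side₁ B a → T ⊆ M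
    absorbed M⊆T B a∈₁ {u} u∈T = ∈-subset⁺ ends? (classify (cover u∈T))
      where
      open Bipartition B
      b∈₂ : Side₂ b
      b∈₂ with cover (M⊆T (∈-subset⁺ ends? (inj₂ refl)))
      ... | inj₁ b∈₁ = ⊥-elim (independent₁ a∈₁ b∈₁ ab)
      ... | inj₂ b∈₂ = b∈₂
      classify : Side₁ u ⊎ Side₂ u → u ≡ a ⊎ u ≡ b
      classify (inj₁ u∈₁) with from (twins u) (inj₂ (Adj-sym (across u∈₁ b∈₂)))
      ... | inj₁ u≡a = inj₁ u≡a
      ... | inj₂ au  = ⊥-elim (independent₁ a∈₁ u∈₁ au)
      classify (inj₂ u∈₂) with to (twins u) (inj₂ (across a∈₁ u∈₂))
      ... | inj₁ u≡b = inj₂ u≡b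
      ... | inj₂ bu  = ⊥-elim (independent₂ b∈₂ u∈₂ bu)

  Independent : List (Fin n) → Set
  Independent L = ∀ {a b} → a ∈ₗ L → b ∈ₗ L → ¬ Adj a b

  independent-[_] : ∀ a → Independent [ a ]
  independent-[ a ] (here refl) (here refl) = irrefl a

  module Greedy {P : Pred (Fin n) 0ℓ} (P? : Decidable P) where

    extend : List (Fin n) → List (Fin n) → List (Fin n)
    extend []       L = L
    extend (u ∷ us) L with P? u ×-dec ¬? (Any.any? (adj? u) L)
    ... | yes _ = extend us (u ∷ L)
    ... | no _  = extend us L

    ⊆-extend : ∀ us L → L ⊆ₗ extend us L
    ⊆-extend []       L = id
    ⊆-extend (u ∷ us) L with P? u ×-dec ¬? (Any.any? (adj? u) L)
    ... | yes _ = ⊆-extend us (u ∷ L) ∘ there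
    ... | no _  = ⊆-extend us L

    extend-All : ∀ us L → All P L → All P (extend us L)
    extend-All []       L all = all
    extend-All (u ∷ us) L all with P? u ×-dec ¬? (Any.any? (adj? u) L)
    ... | yes (pu , _) = extend-All us (u ∷ L) (pu ∷ all)
    ... | no _         = extend-All us L all

    extend-independent : ∀ us L → Independent L → Independent (extend us L)
    extend-independent []       L ind = ind
    extend-independent (u ∷ us) L ind with P? u ×-dec ¬? (Any.any? (adj? u) L)
    ... | yes (_ , fresh) = extend-independent us (u ∷ L) ind′
      where
      ind′ : Independent (u ∷ L)
      ind′ (here refl) (here refl) = irrefl u
      ind′ (here refl) (there b∈) = λ ub → fresh (Any.map (λ { refl → ub }) b∈)
      ind′ (there a∈) (here refl) = λ au → fresh (Any.map (λ { refl → Adj-sym au }) a∈)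
      ind′ (there a∈) (there b∈) = ind a∈ b∈
    ... | no _ = extend-independent us L ind

    extend-maximal : ∀ us L {u} → u ∈ₗ us → P u → u ∈ₗ extend us L ⊎ Any (Adj u) (extend us L)
    extend-maximal (u ∷ us) L (here refl) pu with P? u ×-dec ¬? (Any.any? (adj? u) L)
    ... | yes _ = inj₁ (⊆-extend us (u ∷ L) (here refl))
    ... | no ¬new = inj₂ (Any-resp-⊆ (⊆-extend us L)
                            (decidable-stable (Any.any? (adj? u) L) (λ stale → ¬new (pu , stale))))
    extend-maximal (u ∷ us) L (there v∈) pv with P? u ×-dec ¬? (Any.any? (adj? u) L)
    ... | yes _ = extend-maximal us (u ∷ L) v∈ pv
    ... | no _  = extend-maximal us L v∈ pv

  record Star (M : Subset n) (c : Fin n) : Set where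
    field
      leaves      : List (Fin n)
      ∈⇔          : ∀ {u} → u ∈ M ⇔ (u ≡ c ⊎ u ∈ₗ leaves)
      adjacent    : All (Adj c) leaves
      independent : Independent leaves
      leaf₁ leaf₂ : Fin n
      leaf₁∈      : leaf₁ ∈ₗ leaves
      leaf₂∈      : leaf₂ ∈ₗ leaves
      leaf₁≢leaf₂ : leaf₁ ≢ leaf₂

    centre≢leaf : ∀ {l} → l ∈ₗ leaves → c ≢ l
    centre≢leaf l∈ refl = irrefl c (All.lookup adjacent l∈)

    ∈-leaves : ∀ {u} → u ∈ M → u ≢ c → u ∈ₗ leaves
    ∈-leaves u∈ u≢c with to ∈⇔ u∈
    ... | inj₁ u≡c = ⊥-elim (u≢c u≡c)
    ... | inj₂ u∈L = u∈L

  open Star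

  record StarBiclique (c : Fin n) (L : List (Fin n)) : Set where
    field
      carrier    : Subset n
      isBiclique : IsBiclique G carrier
      shape      : Star carrier c
      ⊆leaves    : L ⊆ₗ leaves shape

  star-centre-unique : ∀ {M c c′} → Star M c → Star M c′ → c ≡ c′
  star-centre-unique {c = c} {c′} S T with c ≟ c′
  ... | yes c≡c′ = c≡c′
  ... | no c≢c′ = ⊥-elim (leaf₁≢leaf₂ S (trans (is-c′ (leaf₁∈ S)) (sym (is-c′ (leaf₂∈ S)))))
    where
    c′∈leaves : c′ ∈ₗ leaves S
    c′∈leaves = ∈-leaves S (from (∈⇔ T) (inj₁ refl)) (c≢c′ ∘ sym)
    -- a leaf of S other than c′ would be a leaf of T, hence adjacent to the leaf c′ of S
    is-c′ : ∀ {l} → l ∈ₗ leaves S → l ≡ c′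
    is-c′ {l} l∈ with l ≟ c′
    ... | yes l≡c′ = l≡c′
    ... | no l≢c′ = ⊥-elim (independent S c′∈leaves l∈
                      (All.lookup (adjacent T) (∈-leaves T (from (∈⇔ S) (inj₂ l∈)) l≢c′)))

  star-not-edge : ∀ {M c a b} → Star M c → ¬ IsEdge M a b
  star-not-edge S E = no-three-in-pair
    (centre≢leaf S (leaf₁∈ S)) (leaf₁≢leaf₂ S) (centre≢leaf S (leaf₂∈ S))
    (to E (from (∈⇔ S) (inj₁ refl)))
    (to E (from (∈⇔ S) (inj₂ (leaf₁∈ S))))
    (to E (from (∈⇔ S) (inj₂ (leaf₂∈ S))))

  module _ (no-C4 : ¬ HasInducedC4 G) where

    star-isBiclique : ∀ {c R a b} → All (Adj c) R → Independent R →
      (∀ {u} → Adj c u → u ∈ₗ R ⊎ Any (Adj u) R) → a ∈ₗ R → b ∈ₗ R → a ≢ b →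
      IsBiclique G (subset ((_≟ c) ∪? (_∈? R)))
    star-isBiclique {c} {R} {a} {b} R⊆N ind maximal a∈ b∈ a≢b =
      isBiclique⁺ S-cb (∈-subset⁺ member? (inj₁ refl)) absorbed
      where
      member? : Decidable (λ u → u ≡ c ⊎ u ∈ₗ R)
      member? = (_≟ c) ∪? (_∈? R)
      S-cb : IsInducedCompleteBipartite G (subset member?)
      S-cb = complete-bipartite (_≟ c) (_∈? R) (c , refl) (a , a∈)
        (λ { refl v∈ → All.lookup R⊆N v∈ }) (λ { refl refl → irrefl c }) ind
      absorbed : ∀ {T} → subset member? ⊆ T → (B : Bipartition T) → Bipartition.Side₁ B c →
        T ⊆ subset member?
      absorbed S⊆T B c∈₁ {u} u∈T = ∈-subset⁺ member? (classify (cover u∈T))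
        where
        open Bipartition B
        leaf-side : ∀ {l} → l ∈ₗ R → Side₂ l
        leaf-side l∈ with cover (S⊆T (∈-subset⁺ member? (inj₂ l∈)))
        ... | inj₁ l∈₁ = ⊥-elim (independent₁ c∈₁ l∈₁ (All.lookup R⊆N l∈))
        ... | inj₂ l∈₂ = l∈₂
        classify : Side₁ u ⊎ Side₂ u → u ≡ c ⊎ u ∈ₗ R
        classify (inj₁ u∈₁) with u ≟ c
        ... | yes u≡c = inj₁ u≡c
        ... | no u≢c = ⊥-elim (no-C4 (c , a , u , b , u≢c ∘ sym , a≢b ,
              All.lookup R⊆N a∈ , Adj-sym (across u∈₁ (leaf-side a∈)) , across u∈₁ (leaf-side b∈) ,
              Adj-sym (All.lookup R⊆N b∈) , independent₁ c∈₁ u∈₁ , ind a∈ b∈))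
        classify (inj₂ u∈₂) with maximal (across c∈₁ u∈₂)
        ... | inj₁ u∈R = inj₂ u∈R
        ... | inj₂ adj-leaf with find adj-leaf
        ...   | l , l∈ , ul = ⊥-elim (independent₂ u∈₂ (leaf-side l∈) ul)

    -- The leaves form a maximal independent subset of N(c) containing L; w guarantees a second leaf.
    star : ∀ c {L p w} → All (Adj c) L → Independent L → p ∈ₗ L → Adj c w → ¬ InN[_] G p w →
      StarBiclique c L
    star c {L} {p} {w} L⊆N L-ind p∈ cw w∉N[p] = record
      { carrier    = subset member?
      ; isBiclique = star-isBiclique (adjacent S) (independent S) R-maximal
                       (leaf₁∈ S) (leaf₂∈ S) (leaf₁≢leaf₂ S)
      ; shape      = S
      ; ⊆leaves    = ⊆-extend (allFin n) L
      }
      where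
      open Greedy (adj? c)
      R : List (Fin n)
      R = extend (allFin n) L
      R-maximal : ∀ {u} → Adj c u → u ∈ₗ R ⊎ Any (Adj u) R
      R-maximal {u} = extend-maximal (allFin n) L (∈-allFin u)
      second-leaf : ∃ λ q → q ∈ₗ R × p ≢ q
      second-leaf with R-maximal cw
      ... | inj₁ w∈R = w , w∈R , w∉N[p] ∘ inj₁ ∘ sym
      ... | inj₂ adj-leaf with find adj-leaf
      ...   | l , l∈ , wl = l , l∈ , λ { refl → w∉N[p] (inj₂ (Adj-sym wl)) }
      member? : Decidable (λ u → u ≡ c ⊎ u ∈ₗ R)
      member? = (_≟ c) ∪? (_∈? R)
      S : Star (subset member?) c
      S = record
        { leaves      = R
        ; ∈⇔          = mk⇔ (∈-subset⁻ member?) (∈-subset⁺ member?)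
        ; adjacent    = extend-All (allFin n) L L⊆N
        ; independent = extend-independent (allFin n) L L-ind
        ; leaf₁       = p
        ; leaf₂       = proj₁ second-leaf
        ; leaf₁∈      = ⊆-extend (allFin n) L p∈
        ; leaf₂∈      = proj₁ (proj₂ second-leaf)
        ; leaf₁≢leaf₂ = proj₂ (proj₂ second-leaf)
        }

  InN? : ∀ v w → Dec (InN[_] G v w)
  InN? v w = (w ≟ v) ⊎-dec adj? v w

  simplicial? : ∀ v → Simplicial G v ⊎ ∃₂ λ a b → Adj v a × Adj v b × ¬ InN[_] G a b
  simplicial? v with any? (λ a → any? (λ b → adj? v a ×-dec adj? v b ×-dec ¬? (InN? a b)))
  ... | yes witness = inj₂ witness
  ... | no none = inj₁ simplicial
    where
    simplicial : Simplicial G v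
    simplicial a b (inj₁ refl) (inj₁ refl) a≢b = ⊥-elim (a≢b refl)
    simplicial a b (inj₁ refl) (inj₂ vb)   _   = vb
    simplicial a b (inj₂ va)   (inj₁ refl) _   = Adj-sym va
    simplicial a b (inj₂ va)   (inj₂ vb)   a≢b = decidable-stable (adj? a b) λ ¬ab →
      none (a , b , va , vb , λ { (inj₁ b≡a) → a≢b (sym b≡a) ; (inj₂ ab) → ¬ab ab })

  Simplicial? : Decidable (Simplicial G)
  Simplicial? v with simplicial? v
  ... | inj₁ sv = yes sv
  ... | inj₂ (a , b , va , vb , b∉N[a]) =
    no λ sv → b∉N[a] (inj₂ (sv a b (inj₂ va) (inj₂ vb) (b∉N[a] ∘ inj₁ ∘ sym)))

  alone? : ∀ {x} → Simplicial G x → Alone G x ⊎ ∃ λ y → Adj x y × Simplicial G y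
  alone? {x} sx with any? (λ y → adj? x y ×-dec Simplicial? y)
  ... | yes witness = inj₂ witness
  ... | no none = inj₁ (sx , λ y xy sy → none (y , xy , sy))

  Alone? : Decidable (Alone G)
  Alone? x with Simplicial? x
  ... | no ¬sx = no (¬sx ∘ proj₁)
  ... | yes sx with alone? sx
  ...   | inj₁ ax = yes ax
  ...   | inj₂ (y , xy , sy) = no λ ax → proj₂ ax y xy sy

  undominated-witness : ∀ {v p} → Adj v p → ¬ DominatedBy G v p → ∃ λ w → Adj v w × ¬ InN[_] G p w
  undominated-witness {v} {p} vp ¬dom with any? (λ w → adj? v w ×-dec ¬? (InN? p w))
  ... | yes witness = witness
  ... | no none = ⊥-elim (¬dom dominated)
    where
    dominated : DominatedBy G v p
    dominated _ (inj₁ refl) = inj₂ (Adj-sym vp)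
    dominated w (inj₂ vw)   = decidable-stable (InN? p w) λ w∉N[p] → none (w , vw , w∉N[p])

  simplicial-dominated : ∀ {t s} → Simplicial G t → Adj t s → DominatedBy G t s
  simplicial-dominated _ ts _ (inj₁ refl) = inj₂ (Adj-sym ts)
  simplicial-dominated {s = s} st ts w (inj₂ tw) with w ≟ s
  ... | yes w≡s = inj₁ w≡s
  ... | no w≢s  = inj₂ (st s w (inj₂ ts) (inj₂ tw) (w≢s ∘ sym))

  simplicial-twins : ∀ {t s} → Simplicial G t → Simplicial G s → Adj t s → TrueTwins G t s
  simplicial-twins {t} st ss ts = (λ { refl → irrefl t ts }) ,
    λ w → mk⇔ (simplicial-dominated st ts w) (simplicial-dominated ss (Adj-sym ts) w)

  alone-nonadjacent : ∀ {x y} → Alone G x → Alone G y → ¬ Adj x y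
  alone-nonadjacent (_ , no-simplicial-neighbour) (sy , _) xy = no-simplicial-neighbour _ xy sy

  module Charging (no-C4 : ¬ HasInducedC4 G) (f : Fin n → Fin n × Fin n)
                  (good : IsGoodAssignment G f) where

    pivot partner : Fin n → Fin n
    pivot   i = proj₁ (f i)
    partner i = proj₂ (f i)

    module _ {i} (ai : Alone G i) where

      adj-pivot : Adj i (pivot i)
      adj-pivot = proj₁ (proj₁ good i ai)

      adj-partner : Adj i (partner i)
      adj-partner = proj₁ (proj₂ (proj₁ good i ai))

      pivot-partner : Adj (pivot i) (partner i)
      pivot-partner = proj₁ (proj₂ (proj₂ (proj₁ good i ai)))

      undominated-or-twins : ¬ DominatedBy G (pivot i) (partner i) ⊎ TrueTwins G (pivot i) (partner i)
      undominated-or-twins = proj₂ (proj₂ (proj₂ (proj₁ good i ai)))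

    data Charge (i : Fin n) (M : Subset n) : Set where
      centre     : Star M i → Charge i M
      alone-star : Alone G i → (S : Star M (pivot i)) → partner i ∈ₗ leaves S →
                   (∀ {y} → Alone G y → Adj (pivot i) y → ¬ Adj (partner i) y → y ∈ₗ leaves S) →
                   Charge i M
      alone-edge : Alone G i → TrueTwins G (pivot i) (partner i) → IsEdge M (pivot i) (partner i) →
                   Charge i M
      twin-edge  : ∀ s → Simplicial G i → IsEdge M i s → Charge i M

    label : ∀ {i M} → Charge i M → Fin 2
    label (centre _)            = zero
    label (alone-star _ _ _ _)  = suc zero
    label (alone-edge _ _ _)    = zero
    label {i} (twin-edge s _ _) = orientation i s

    Charged : Fin n → Set
    Charged i = Σ (Subset n) λ M → IsBiclique G M × Charge i M

    centre-charge : ∀ {i a b} → Adj i a → Adj i b → ¬ InN[_] G a b → Charged i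
    centre-charge {i} {a} ia ib b∉N[a] = carrier , isBiclique , centre shape
      where open StarBiclique (star no-C4 i (ia ∷ []) independent-[ a ] (here refl) ib b∉N[a])

    twin-edge-charge : ∀ {i s} → Simplicial G i → Simplicial G s → Adj i s → Charged i
    twin-edge-charge {s = s} si ss is with twins-isBiclique is (simplicial-twins si ss is)
    ... | M , M-bi , E = M , M-bi , twin-edge s si E

    alone-star-charge : ∀ {i} → Alone G i → ¬ DominatedBy G (pivot i) (partner i) → Charged i
    alone-star-charge {i} ai undominated =
      carrier , isBiclique , alone-star ai shape (⊆leaves (here refl)) seeded
      where
      v p : Fin n
      v = pivot i
      p = partner i
      seed? : Decidable (λ y → Alone G y × Adj v y × ¬ Adj p y)
      seed? y = Alone? y ×-dec adj? v y ×-dec ¬? (adj? p y)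
      seeds : List (Fin n)
      seeds = filter seed? (allFin n)
      seed : ∀ {y} → y ∈ₗ seeds → Alone G y × Adj v y × ¬ Adj p y
      seed = proj₂ ∘ ∈-filter⁻ seed? {xs = allFin n}
      L-ind : Independent (p ∷ seeds)
      L-ind (here refl) (here refl)  = irrefl p
      L-ind (here refl) (there y∈)   = proj₂ (proj₂ (seed y∈))
      L-ind (there y∈)  (here refl)  = proj₂ (proj₂ (seed y∈)) ∘ Adj-sym
      L-ind (there y∈)  (there y′∈)  = alone-nonadjacent (proj₁ (seed y∈)) (proj₁ (seed y′∈))
      witness : ∃ λ w → Adj v w × ¬ InN[_] G p w
      witness = undominated-witness (pivot-partner ai) undominated
      open StarBiclique (star no-C4 v (pivot-partner ai ∷ All.tabulate (proj₁ ∘ proj₂ ∘ seed))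
                          L-ind (here refl) (proj₁ (proj₂ witness)) (proj₂ (proj₂ witness)))
      seeded : ∀ {y} → Alone G y → Adj v y → ¬ Adj p y → y ∈ₗ leaves shape
      seeded ay vy ¬py = ⊆leaves (there (∈-filter⁺ seed? (∈-allFin _) (ay , vy , ¬py)))

    alone-charge : ∀ {i} → Alone G i → Charged i
    alone-charge ai with undominated-or-twins ai
    ... | inj₁ undominated = alone-star-charge ai undominated
    ... | inj₂ twins with twins-isBiclique (pivot-partner ai) twins
    ...   | M , M-bi , E = M , M-bi , alone-edge ai twins E

    charge : ∀ i → Charged i
    charge i with simplicial? i
    ... | inj₂ (_ , _ , ia , ib , b∉N[a]) = centre-charge ia ib b∉N[a]
    ... | inj₁ si with alone? si
    ...   | inj₂ (_ , is , ss) = twin-edge-charge si ss is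
    ...   | inj₁ ai = alone-charge ai

    alone-stars-clash : ∀ {i j M} → i ≢ j → Alone G i → Alone G j →
      (S : Star M (pivot i)) → partner i ∈ₗ leaves S →
      (∀ {y} → Alone G y → Adj (pivot i) y → ¬ Adj (partner i) y → y ∈ₗ leaves S) →
      (T : Star M (pivot j)) → partner j ∈ₗ leaves T → ⊥
    alone-stars-clash {i} {j} i≢j ai aj S p∈S seeded T q∈T = independent S j∈S q∈S (adj-partner aj)
      where
      same-pivot : pivot i ≡ pivot j
      same-pivot = star-centre-unique S T
      q∈S : partner j ∈ₗ leaves S
      q∈S = ∈-leaves S (from (∈⇔ T) (inj₂ q∈T))
              (λ q≡v → centre≢leaf T q∈T (trans (sym same-pivot) (sym q≡v)))
      p≢q : partner i ≢ partner j
      p≢q p≡q = proj₂ (proj₂ good i j ai aj i≢j (inj₁ (same-pivot , p≡q))) same-pivot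
      ¬pj : ¬ Adj (partner i) j
      ¬pj pj = independent S p∈S q∈S
                 (proj₁ aj (partner i) (partner j) (inj₂ (Adj-sym pj)) (inj₂ (adj-partner aj)) p≢q)
      j∈S : j ∈ₗ leaves S
      j∈S = seeded aj (subst (λ v → Adj v j) (sym same-pivot) (Adj-sym (adj-pivot aj))) ¬pj

    alone-edges-clash : ∀ {i j M} → i ≢ j → Alone G i → Alone G j →
      TrueTwins G (pivot i) (partner i) → IsEdge M (pivot i) (partner i) →
      IsEdge M (pivot j) (partner j) → ⊥
    alone-edges-clash {i} {j} i≢j ai aj twins E F =
      proj₁ (proj₂ good i j ai aj i≢j (same-edge E F (proj₁ twins))) twins

    alone-edge-twin-edge-clash : ∀ {i t s M} → Alone G i → IsEdge M (pivot i) (partner i) →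
      IsEdge M t s → Simplicial G t → ⊥
    alone-edge-twin-edge-clash ai E F st with to E (from F (inj₁ refl))
    ... | inj₁ refl = proj₂ ai _ (adj-pivot ai) st
    ... | inj₂ refl = proj₂ ai _ (adj-partner ai) st

    clash : ∀ {i j M} → i ≢ j → (c : Charge i M) (d : Charge j M) → label c ≢ label d
    clash i≢j (centre S)            (centre T)            _ = i≢j (star-centre-unique S T)
    clash _   (centre _)            (alone-star _ _ _ _)  ()
    clash _   (centre S)            (alone-edge _ _ F)    _ = star-not-edge S F
    clash _   (centre S)            (twin-edge _ _ F)     _ = star-not-edge S F
    clash _   (alone-star _ _ _ _)  (centre _)            ()
    clash i≢j (alone-star ai S p∈ seeded) (alone-star aj T q∈ _) _ =
      alone-stars-clash i≢j ai aj S p∈ seeded T q∈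
    clash _   (alone-star _ S _ _)  (alone-edge _ _ F)    _ = star-not-edge S F
    clash _   (alone-star _ S _ _)  (twin-edge _ _ F)     _ = star-not-edge S F
    clash _   (alone-edge _ _ E)    (centre T)            _ = star-not-edge T E
    clash _   (alone-edge _ _ E)    (alone-star _ T _ _)  _ = star-not-edge T E
    clash i≢j (alone-edge ai tw E)  (alone-edge aj _ F)   _ = alone-edges-clash i≢j ai aj tw E F
    clash _   (alone-edge ai _ E)   (twin-edge _ sj F)    _ = alone-edge-twin-edge-clash ai E F sj
    clash _   (twin-edge _ _ E)     (centre T)            _ = star-not-edge T E
    clash _   (twin-edge _ _ E)     (alone-star _ T _ _)  _ = star-not-edge T E
    clash _   (twin-edge _ si E)    (alone-edge aj _ F)   _ = alone-edge-twin-edge-clash aj F E si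
    clash i≢j (twin-edge _ _ E)     (twin-edge _ _ F)     same = orientations-of-edge-differ i≢j E F same

    biclique : Fin n → Subset n
    biclique i = proj₁ (charge i)

    biclique-isBiclique : ∀ i → IsBiclique G (biclique i)
    biclique-isBiclique i = proj₁ (proj₂ (charge i))

    key : Fin n → Fin 2
    key i = label (proj₂ (proj₂ (charge i)))

    charge-separates : ∀ i j → biclique i ≡ biclique j → key i ≡ key j → i ≡ j
    charge-separates i j with charge i | charge j
    ... | _ , _ , c | _ , _ , d = λ { refl same-key →
      decidable-stable (i ≟ j) λ i≢j → clash i≢j c d same-key }

theorem3p4 : (n : ℕ) → 3 ≤ n → (G : Graph n) → Connected G → ¬ HasInducedC4 G →
    (∀ u v → ¬ FalseTwins G u v) → HasGoodAssignment G →
    AtLeastBicliques G ⌈ n /2⌉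
theorem3p4 n _ G _ no-C4 _ (f , good) =
  image _≟ˢ_ biclique , image-unique _≟ˢ_ biclique , All.tabulate image-bicliques ,
  ⌈/2⌉-≤ (≤-length-image _≟ˢ_ biclique key charge-separates)
  where
  open Charging G no-C4 f good
  _≟ˢ_ = ≡-dec _≟ᵇ_
  image-bicliques : ∀ {M} → M ∈ₗ image _≟ˢ_ biclique → IsBiclique G M
  image-bicliques M∈ with ∈-image⁻ _≟ˢ_ biclique M∈
  ... | i , refl = biclique-isBiclique i
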